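{- Let $n$ be an odd positive integer. For every edge $j\to i$ of $U_n$, we have $\delta(i,j)-\delta(j,i)=1$.
   Context: $U_n$ is the tournament on vertex set $\{0,1,\dots,n-1\}$ where, for each pair $i<j$, the edge is directed $i\to j$ if $i+j$ is odd and $j\to i$ if $i+j$ is even. For vertices $u,v$, $\delta(u,v)$ is the number of directed paths of length $2$ from $u$ to $v$, i.e. the number of vertices $w$ with $u\to w$ and $w\to v$. -}

module Defs where

open import Data.Nat using (ℕ; _+_; _<_; _<ᵇ_)
open import Data.Nat.Base using (_%_)
open import Data.Bool using (Bool; true; false; _∧_; _∨_; not; T)
open import Data.Nat using (_≡ᵇ_)
open import Data.Fin using (Fin; toℕ)
open import Data.List using (List; length; filter)
open import Data.List.Base using (allFin)
open import Relation.Nullary.Decidable using (does)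
open import Data.Bool.Properties using (T?)

odd? : ℕ → Bool
odd? m = (m % 2) ≡ᵇ 1

arcᵇ : ℕ → ℕ → Bool
arcᵇ i j = ((i <ᵇ j) ∧ odd? (i + j)) ∨ ((j <ᵇ i) ∧ not (odd? (i + j)))

_⟶_ : {n : ℕ} → Fin n → Fin n → Set
u ⟶ v = T (arcᵇ (toℕ u) (toℕ v))

δ : {n : ℕ} → Fin n → Fin n → ℕ
δ {n} u v = length (filter (λ w → T? (arcᵇ (toℕ u) (toℕ w) ∧ arcᵇ (toℕ w) (toℕ v))) (allFin n))

-- For an arc b → a of a tournament, look at each vertex m separately: the
-- indicators satisfy [a→m→b] + [b→m] = [b→m→a] + [m = a] + [a→m], so summing
-- over all m gives δ(a,b) + d⁺(b) = δ(b,a) + 1 + d⁺(a).  For odd n = 2k + 1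
-- the tournament U_n is k-regular: v beats exactly one of any two consecutive
-- vertices m, m + 1 lying on the same side of v, because v + m and v + m + 1
-- have opposite parities.  Hence δ(a,b) - δ(b,a) = 1.
module Submission where

open import Defs
open import Data.Nat using (ℕ; suc; _*_)
open import Data.Fin using (Fin)
open import Data.Integer using (+_; _-_)
open import Relation.Binary.PropositionalEquality using (_≡_)

open import Data.Bool using (Bool; true; false; _∧_; not)
open import Data.Bool.Properties using (T?; T-≡; not-involutive; ∨-identityʳ)
open import Data.Fin using (toℕ)
open import Data.Fin.Properties using (toℕ<n)
open import Data.Integer using (_⊖_)
open import Data.Integer.Properties using (m-n≡m⊖n; ⊖-≥)
open import Data.List using (List; []; _∷_; _∷ʳ_; length; filter; map; tabulate; applyUpTo; upTo; allFin)
open import Data.List.Properties using (upTo-∷ʳ; map-tabulate)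
open import Data.Nat using (zero; _+_; _∸_; _≤_; _<_; _<ᵇ_; s≤s; _≟_)
open import Data.Nat.Properties
  using (+-commutativeSemigroup; +-identityʳ; +-suc; +-comm; +-assoc; +-cancelʳ-≡; *-suc;
         ≤-refl; ≤-antisym; ≤-pred; n≤1+n; n<1+n; <⇒≤; <⇒≢; >⇒≢; ≤∧≢⇒<; m<n⇒m<1+n;
         m≤n⇒m<n∨m≡n; m≤n+m; m≤m+n; m+n∸m≡n; <-cmp; <⇒<ᵇ)
open import Data.Sum using (inj₁; inj₂)
open import Function using (_∘_; id)
open import Function.Bundles using (Equivalence)
open import Relation.Binary using (Tri; tri<; tri≈; tri>)
open import Relation.Binary.Definitions using (DecidableEquality)
open import Relation.Binary.PropositionalEquality
  using (_≢_; refl; sym; trans; subst; cong; cong₂; ≢-sym; module ≡-Reasoning)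
open import Relation.Nullary using (does; yes; no; contradiction)
open import Relation.Nullary.Decidable using (dec-true; dec-false)

open import Algebra.Properties.CommutativeSemigroup +-commutativeSemigroup using (interchange)
open ≡-Reasoning

⟦_⟧ : Bool → ℕ
⟦ true ⟧  = 1
⟦ false ⟧ = 0

⟦x⟧+⟦not-x⟧≡1 : ∀ x → ⟦ x ⟧ + ⟦ not x ⟧ ≡ 1
⟦x⟧+⟦not-x⟧≡1 true  = refl
⟦x⟧+⟦not-x⟧≡1 false = refl

-- Phrased exactly as in δ, so that δ u v is a count over allFin n by definition.
count : {A : Set} → (A → Bool) → List A → ℕ
count p xs = length (filter (T? ∘ p) xs)

module _ {A : Set} (p : A → Bool) where

  count-∷ : ∀ x xs → count p (x ∷ xs) ≡ ⟦ p x ⟧ + count p xs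
  count-∷ x xs with p x
  ... | true  = refl
  ... | false = refl

  count-∷ʳ : ∀ xs x → count p (xs ∷ʳ x) ≡ count p xs + ⟦ p x ⟧
  count-∷ʳ []       x = trans (count-∷ x []) (+-identityʳ _)
  count-∷ʳ (y ∷ ys) x with p y
  ... | true  = cong suc (count-∷ʳ ys x)
  ... | false = count-∷ʳ ys x

count-map : {A B : Set} (p : B → Bool) (f : A → B) (xs : List A) →
            count p (map f xs) ≡ count (p ∘ f) xs
count-map p f []       = refl
count-map p f (x ∷ xs) with p (f x)
... | true  = cong suc (count-map p f xs)
... | false = count-map p f xs

count-pointwise : {A : Set} {p q r s t : A → Bool} →
                  (∀ x → ⟦ p x ⟧ + ⟦ q x ⟧ ≡ ⟦ r x ⟧ + ⟦ s x ⟧ + ⟦ t x ⟧) →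
                  ∀ xs → count p xs + count q xs ≡ count r xs + count s xs + count t xs
count-pointwise h []       = refl
count-pointwise {p = p} {q} {r} {s} {t} h (x ∷ xs) = begin
  count p (x ∷ xs) + count q (x ∷ xs)
    ≡⟨ cong₂ _+_ (count-∷ p x xs) (count-∷ q x xs) ⟩
  (⟦ p x ⟧ + count p xs) + (⟦ q x ⟧ + count q xs)
    ≡⟨ interchange ⟦ p x ⟧ (count p xs) ⟦ q x ⟧ (count q xs) ⟩
  (⟦ p x ⟧ + ⟦ q x ⟧) + (count p xs + count q xs)
    ≡⟨ cong₂ _+_ (h x) (count-pointwise h xs) ⟩
  (⟦ r x ⟧ + ⟦ s x ⟧ + ⟦ t x ⟧) + (count r xs + count s xs + count t xs)
    ≡⟨ interchange (⟦ r x ⟧ + ⟦ s x ⟧) ⟦ t x ⟧ (count r xs + count s xs) (count t xs) ⟩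
  (⟦ r x ⟧ + ⟦ s x ⟧ + (count r xs + count s xs)) + (⟦ t x ⟧ + count t xs)
    ≡⟨ cong (_+ (⟦ t x ⟧ + count t xs)) (interchange ⟦ r x ⟧ ⟦ s x ⟧ (count r xs) (count s xs)) ⟩
  (⟦ r x ⟧ + count r xs) + (⟦ s x ⟧ + count s xs) + (⟦ t x ⟧ + count t xs)
    ≡⟨ sym (cong₂ _+_ (cong₂ _+_ (count-∷ r x xs) (count-∷ s x xs)) (count-∷ t x xs)) ⟩
  count r (x ∷ xs) + count s (x ∷ xs) + count t (x ∷ xs) ∎

count-upTo-suc : (p : ℕ → Bool) (n : ℕ) → count p (upTo (suc n)) ≡ count p (upTo n) + ⟦ p n ⟧
count-upTo-suc p n = trans (cong (count p) (sym (upTo-∷ʳ n))) (count-∷ʳ p (upTo n) n)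

tabulate-∘toℕ : {A : Set} (n : ℕ) (f : ℕ → A) → tabulate (f ∘ toℕ {n}) ≡ applyUpTo f n
tabulate-∘toℕ zero    f = refl
tabulate-∘toℕ (suc n) f = cong (f 0 ∷_) (tabulate-∘toℕ n (f ∘ suc))

count-allFin : (p : ℕ → Bool) (n : ℕ) → count (p ∘ toℕ) (allFin n) ≡ count p (upTo n)
count-allFin p n = begin
  count (p ∘ toℕ) (allFin n)      ≡⟨ count-map p toℕ (allFin n) ⟨
  count p (map toℕ (allFin n))    ≡⟨ cong (count p) (map-tabulate {n = n} id toℕ) ⟩
  count p (tabulate (toℕ {n}))    ≡⟨ cong (count p) (tabulate-∘toℕ n id) ⟩
  count p (upTo n)                ∎

count-≟-upTo≡0 : ∀ {a n} → n ≤ a → count (λ m → does (m ≟ a)) (upTo n) ≡ 0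
count-≟-upTo≡0 {n = zero}  _   = refl
count-≟-upTo≡0 {a} {suc n} n<a = begin
  count (λ m → does (m ≟ a)) (upTo (suc n))              ≡⟨ count-upTo-suc _ n ⟩
  count (λ m → does (m ≟ a)) (upTo n) + ⟦ does (n ≟ a) ⟧
    ≡⟨ cong₂ _+_ (count-≟-upTo≡0 (<⇒≤ n<a)) (cong ⟦_⟧ (dec-false (n ≟ a) (<⇒≢ n<a))) ⟩
  0                                                      ∎

count-≟-upTo≡1 : ∀ {a n} → a < n → count (λ m → does (m ≟ a)) (upTo n) ≡ 1
count-≟-upTo≡1 {a} {suc n} (s≤s a≤n) with m≤n⇒m<n∨m≡n a≤n
... | inj₁ a<n  = trans (count-upTo-suc _ n)
                    (cong₂ _+_ (count-≟-upTo≡1 a<n) (cong ⟦_⟧ (dec-false (n ≟ a) (>⇒≢ a<n))))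
... | inj₂ refl = trans (count-upTo-suc _ n)
                    (cong₂ _+_ (count-≟-upTo≡0 {n} ≤-refl) (cong ⟦_⟧ (dec-true (n ≟ n) refl)))

module Tournament {V : Set} (_≟ᵥ_ : DecidableEquality V) (arc : V → V → Bool)
                  (arc-irrefl : ∀ v → arc v v ≡ false)
                  (arc-flip : ∀ {u v} → u ≢ v → arc v u ≡ not (arc u v)) where

  twoPaths : List V → V → V → ℕ
  twoPaths vs u v = count (λ w → arc u w ∧ arc w v) vs

  outDegree : List V → V → ℕ
  outDegree vs u = count (arc u) vs

  twoPaths-pointwise : ∀ {a b} → arc b a ≡ true → ∀ m →
    ⟦ arc a m ∧ arc m b ⟧ + ⟦ arc b m ⟧ ≡ ⟦ arc b m ∧ arc m a ⟧ + ⟦ does (m ≟ᵥ a) ⟧ + ⟦ arc a m ⟧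
  twoPaths-pointwise {a} {b} b→a m with m ≟ᵥ a
  ... | yes refl rewrite arc-irrefl a | b→a = refl
  ... | no m≢a with m ≟ᵥ b
  ...   | yes refl rewrite arc-irrefl m | arc-flip m≢a | b→a = refl
  ...   | no m≢b rewrite arc-flip (≢-sym m≢a) | arc-flip (≢-sym m≢b) with arc a m | arc b m
  ...     | true  | true  = refl
  ...     | true  | false = refl
  ...     | false | true  = refl
  ...     | false | false = refl

  twoPaths-balance : ∀ {a b} → arc b a ≡ true → ∀ vs →
    twoPaths vs a b + outDegree vs b ≡ twoPaths vs b a + count (λ m → does (m ≟ᵥ a)) vs + outDegree vs a
  twoPaths-balance b→a = count-pointwise (twoPaths-pointwise b→a)

odd?-suc : ∀ n → odd? (suc n) ≡ not (odd? n)
odd?-suc zero          = refl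
odd?-suc (suc zero)    = refl
odd?-suc (suc (suc n)) = odd?-suc n

odd?-+-suc : ∀ m n → odd? (m + suc n) ≡ not (odd? (m + n))
odd?-+-suc m n = trans (cong odd? (+-suc m n)) (odd?-suc (m + n))

odd?-double : ∀ m → odd? (m + m) ≡ false
odd?-double zero    = refl
odd?-double (suc m) = trans (cong (odd? ∘ suc) (+-suc m m)) (odd?-double m)

<⇒<ᵇ≡true : ∀ {m n} → m < n → (m <ᵇ n) ≡ true
<⇒<ᵇ≡true m<n = Equivalence.to T-≡ (<⇒<ᵇ m<n)

≤⇒<ᵇ≡false : ∀ {m n} → n ≤ m → (m <ᵇ n) ≡ false
≤⇒<ᵇ≡false {n = zero} _         = refl
≤⇒<ᵇ≡false           (s≤s n≤m) = ≤⇒<ᵇ≡false n≤m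

arcᵇ-< : ∀ {u v} → u < v → arcᵇ u v ≡ odd? (u + v)
arcᵇ-< {u} {v} u<v rewrite <⇒<ᵇ≡true u<v | ≤⇒<ᵇ≡false (<⇒≤ u<v) = ∨-identityʳ (odd? (u + v))

arcᵇ-> : ∀ {u v} → v < u → arcᵇ u v ≡ not (odd? (u + v))
arcᵇ-> v<u rewrite ≤⇒<ᵇ≡false (<⇒≤ v<u) | <⇒<ᵇ≡true v<u = refl

arcᵇ-irrefl : ∀ v → arcᵇ v v ≡ false
arcᵇ-irrefl v rewrite ≤⇒<ᵇ≡false (≤-refl {v}) = refl

arcᵇ-flip : ∀ {u v} → u ≢ v → arcᵇ v u ≡ not (arcᵇ u v)
arcᵇ-flip {u} {v} u≢v with <-cmp u v
... | tri< u<v _ _ rewrite arcᵇ-> u<v | arcᵇ-< u<v | +-comm v u = refl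
... | tri≈ _ u≡v _ = contradiction u≡v u≢v
... | tri> _ _ v<u rewrite arcᵇ-< v<u | arcᵇ-> v<u | +-comm v u = sym (not-involutive _)

arcᵇ-suc : ∀ {v n} → v ≢ n → v ≢ suc n → arcᵇ v (suc n) ≡ not (arcᵇ v n)
arcᵇ-suc {v} {n} v≢n v≢1+n with <-cmp v n
... | tri< v<n _ _ rewrite arcᵇ-< v<n | arcᵇ-< (m<n⇒m<1+n v<n) = odd?-+-suc v n
... | tri≈ _ v≡n _ = contradiction v≡n v≢n
... | tri> _ _ n<v rewrite arcᵇ-> n<v | arcᵇ-> (≤∧≢⇒< n<v (≢-sym v≢1+n)) = cong not (odd?-+-suc v n)

arcᵇ-to-suc : ∀ m → arcᵇ m (suc m) ≡ true
arcᵇ-to-suc m = begin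
  arcᵇ m (suc m)         ≡⟨ arcᵇ-< (n<1+n m) ⟩
  odd? (m + suc m)       ≡⟨ odd?-+-suc m m ⟩
  not (odd? (m + m))     ≡⟨ cong not (odd?-double m) ⟩
  true                   ∎

arcᵇ-from-suc : ∀ m → arcᵇ (suc m) m ≡ false
arcᵇ-from-suc m = trans (arcᵇ-flip (<⇒≢ (n<1+n m))) (cong not (arcᵇ-to-suc m))

open Tournament _≟_ arcᵇ arcᵇ-irrefl arcᵇ-flip

outDegree-upTo-suc : ∀ n v → outDegree (upTo (suc n)) v ≡ outDegree (upTo n) v + ⟦ arcᵇ v n ⟧
outDegree-upTo-suc n v = count-upTo-suc (arcᵇ v) n

outDegree-pair : ∀ {v n} → v ≢ n → v ≢ suc n →
                 outDegree (upTo (2 + n)) v ≡ suc (outDegree (upTo n) v)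
outDegree-pair {v} {n} v≢n v≢1+n = begin
  outDegree (upTo (2 + n)) v
    ≡⟨ outDegree-upTo-suc (suc n) v ⟩
  outDegree (upTo (suc n)) v + ⟦ arcᵇ v (suc n) ⟧
    ≡⟨ cong₂ _+_ (outDegree-upTo-suc n v) (cong ⟦_⟧ (arcᵇ-suc v≢n v≢1+n)) ⟩
  outDegree (upTo n) v + ⟦ arcᵇ v n ⟧ + ⟦ not (arcᵇ v n) ⟧
    ≡⟨ +-assoc (outDegree (upTo n) v) _ _ ⟩
  outDegree (upTo n) v + (⟦ arcᵇ v n ⟧ + ⟦ not (arcᵇ v n) ⟧)
    ≡⟨ cong (λ x → outDegree (upTo n) v + x) (⟦x⟧+⟦not-x⟧≡1 (arcᵇ v n)) ⟩
  outDegree (upTo n) v + 1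
    ≡⟨ +-comm (outDegree (upTo n) v) 1 ⟩
  suc (outDegree (upTo n) v) ∎

outDegree-self : ∀ v → outDegree (upTo (suc v)) v ≡ outDegree (upTo v) v
outDegree-self v = begin
  outDegree (upTo (suc v)) v          ≡⟨ outDegree-upTo-suc v v ⟩
  outDegree (upTo v) v + ⟦ arcᵇ v v ⟧ ≡⟨ cong (λ x → outDegree (upTo v) v + ⟦ x ⟧) (arcᵇ-irrefl v) ⟩
  outDegree (upTo v) v + 0            ≡⟨ +-identityʳ _ ⟩
  outDegree (upTo v) v                ∎

-- The vertex n + 1 loses to n and beats n + 2.
outDegree-triple : ∀ n → outDegree (upTo (3 + n)) (suc n) ≡ suc (outDegree (upTo n) (suc n))
outDegree-triple n = begin
  outDegree (upTo (3 + n)) (suc n)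
    ≡⟨ outDegree-upTo-suc (2 + n) (suc n) ⟩
  outDegree (upTo (2 + n)) (suc n) + ⟦ arcᵇ (suc n) (2 + n) ⟧
    ≡⟨ cong₂ (λ d x → d + ⟦ x ⟧) (outDegree-self (suc n)) (arcᵇ-to-suc (suc n)) ⟩
  outDegree (upTo (suc n)) (suc n) + 1
    ≡⟨ cong (_+ 1) (outDegree-upTo-suc n (suc n)) ⟩
  outDegree (upTo n) (suc n) + ⟦ arcᵇ (suc n) n ⟧ + 1
    ≡⟨ cong (λ x → outDegree (upTo n) (suc n) + ⟦ x ⟧ + 1) (arcᵇ-from-suc n) ⟩
  outDegree (upTo n) (suc n) + 0 + 1
    ≡⟨ cong (_+ 1) (+-identityʳ _) ⟩
  outDegree (upTo n) (suc n) + 1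
    ≡⟨ +-comm _ 1 ⟩
  suc (outDegree (upTo n) (suc n)) ∎

outDegree-below : ∀ t {v} → 2 * t ≤ v → outDegree (upTo (2 * t)) v ≡ t
outDegree-below zero        _      = refl
outDegree-below (suc t) {v} 2t+2≤v = begin
  outDegree (upTo (2 * suc t)) v ≡⟨ cong (λ n → outDegree (upTo n) v) (*-suc 2 t) ⟩
  outDegree (upTo (2 + 2 * t)) v ≡⟨ outDegree-pair (>⇒≢ 2t<v) (>⇒≢ 2t+1<v) ⟩
  suc (outDegree (upTo (2 * t)) v) ≡⟨ cong suc (outDegree-below t (<⇒≤ 2t<v)) ⟩
  suc t                          ∎
  where
  2t+1<v : suc (2 * t) < v
  2t+1<v = subst (_≤ v) (*-suc 2 t) 2t+2≤v
  2t<v : 2 * t < v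
  2t<v = <⇒≤ 2t+1<v

outDegree-regular : ∀ k {v} → v < suc (2 * k) → outDegree (upTo (suc (2 * k))) v ≡ k
outDegree-regular zero    {zero}  _         = refl
outDegree-regular zero    {suc v} (s≤s ())
outDegree-regular (suc k) {v}     v<n       = begin
  outDegree (upTo (suc (2 * suc k))) v ≡⟨ cong (λ m → outDegree (upTo (suc m)) v) (*-suc 2 k) ⟩
  outDegree (upTo (3 + 2 * k)) v       ≡⟨ by-position (<-cmp v (suc (2 * k))) ⟩
  suc k                                ∎
  where
  by-position : Tri (v < suc (2 * k)) (v ≡ suc (2 * k)) (suc (2 * k) < v) →
             outDegree (upTo (3 + 2 * k)) v ≡ suc k
  by-position (tri< v<2k+1 _ _) = begin
    outDegree (upTo (2 + suc (2 * k))) v   ≡⟨ outDegree-pair (<⇒≢ v<2k+1) (<⇒≢ (m<n⇒m<1+n v<2k+1)) ⟩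
    suc (outDegree (upTo (suc (2 * k))) v) ≡⟨ cong suc (outDegree-regular k v<2k+1) ⟩
    suc k                                  ∎
  by-position (tri≈ _ refl _) = begin
    outDegree (upTo (3 + 2 * k)) (suc (2 * k))   ≡⟨ outDegree-triple (2 * k) ⟩
    suc (outDegree (upTo (2 * k)) (suc (2 * k))) ≡⟨ cong suc (outDegree-below k (n≤1+n _)) ⟩
    suc k                                        ∎
  by-position (tri> _ _ 2k+1<v) with ≤-antisym (subst (v ≤_) (*-suc 2 k) (≤-pred v<n)) 2k+1<v
  ... | refl = begin
    outDegree (upTo (3 + 2 * k)) (2 + 2 * k)   ≡⟨ outDegree-self (2 + 2 * k) ⟩
    outDegree (upTo (2 + 2 * k)) (2 + 2 * k)   ≡⟨ outDegree-pair {n = 2 * k} (>⇒≢ (m<n⇒m<1+n (n<1+n _))) (>⇒≢ (n<1+n _)) ⟩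
    suc (outDegree (upTo (2 * k)) (2 + 2 * k)) ≡⟨ cong suc (outDegree-below k (m≤n+m _ 2)) ⟩
    suc k                                      ∎

twoPaths-difference : ∀ k {a b} → a < suc (2 * k) → b < suc (2 * k) → arcᵇ b a ≡ true →
                      twoPaths (upTo (suc (2 * k))) a b ≡ twoPaths (upTo (suc (2 * k))) b a + 1
twoPaths-difference k {a} {b} a<n b<n b→a = +-cancelʳ-≡ k _ _ (begin
  twoPaths vs a b + k
    ≡⟨ cong₂ _+_ refl (outDegree-regular k b<n) ⟨
  twoPaths vs a b + outDegree vs b
    ≡⟨ twoPaths-balance {a} {b} b→a vs ⟩
  twoPaths vs b a + count (λ m → does (m ≟ a)) vs + outDegree vs a
    ≡⟨ cong₂ _+_ (cong₂ _+_ refl (count-≟-upTo≡1 a<n)) (outDegree-regular k a<n) ⟩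
  twoPaths vs b a + 1 + k ∎)
  where
  vs = upTo (suc (2 * k))

δ≡twoPaths : ∀ {n} (i j : Fin n) → δ i j ≡ twoPaths (upTo n) (toℕ i) (toℕ j)
δ≡twoPaths {n} i j = count-allFin (λ m → arcᵇ (toℕ i) m ∧ arcᵇ m (toℕ j)) n

m≡n+d⇒+m-+n≡+d : ∀ {m n d} → m ≡ n + d → + m - + n ≡ + d
m≡n+d⇒+m-+n≡+d {n = n} {d} refl = begin
  + (n + d) - + n   ≡⟨ m-n≡m⊖n (n + d) n ⟩
  (n + d) ⊖ n       ≡⟨ ⊖-≥ (m≤m+n n d) ⟩
  + (n + d ∸ n)     ≡⟨ cong +_ (m+n∸m≡n n d) ⟩
  + d               ∎

lemma4p4 : (k : ℕ) → (i j : Fin (suc (2 * k))) → j ⟶ i →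
           (+ δ i j) - (+ δ j i) ≡ + 1
lemma4p4 k i j j⟶i = m≡n+d⇒+m-+n≡+d (begin
  δ i j
    ≡⟨ δ≡twoPaths i j ⟩
  twoPaths (upTo (suc (2 * k))) (toℕ i) (toℕ j)
    ≡⟨ twoPaths-difference k (toℕ<n i) (toℕ<n j) (Equivalence.to T-≡ j⟶i) ⟩
  twoPaths (upTo (suc (2 * k))) (toℕ j) (toℕ i) + 1
    ≡⟨ cong (_+ 1) (δ≡twoPaths j i) ⟨
  δ j i + 1 ∎)
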